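{- For every integer $n\ge 1$, $$\sum_{k=1}^{n}(-1)^{n-k}\binom{n}{k}a_{k-1}=\begin{cases}\dfrac{(2m)!}{2^m\,m!} & \text{if } n=2m+1,\\[2mm] 0 & \text{if } n=2m.\end{cases}$$
   Context: For $n\ge 0$, $I_1(n)$ denotes the number of involutions in the symmetric group $\mathfrak{S}_n$ (with $I_1(0)=1$), and $a_n=\sum_{j=0}^{n}I_1(j)$. -}

module Defs where

open import Data.Nat using (ℕ; zero; suc; _+_; _*_; _∸_; _^_; NonZero; _!)
open import Data.Nat.Properties using (m*n≢0; m^n≢0)
open import Data.Nat.Combinatorics using (_C_)
open import Data.Nat.Properties using (_!≢0)
open import Data.Fin using (Fin)
open import Data.Fin.Properties using (all?; _≟_)
open import Data.Vec using (Vec; []; _∷_; lookup)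
open import Data.List using (List; []; _∷_; concatMap; map; filter; length; allFin)
open import Data.Integer using (ℤ; +_; -_) renaming (_+_ to _+ℤ_; _*_ to _*ℤ_)
open import Relation.Binary.PropositionalEquality using (_≡_)
open import Relation.Nullary using (Dec)

-- All functions Fin n → Fin n, represented by their value tables
-- (vectors of length k with entries in Fin n, here k = n).
allVecs : (k n : ℕ) → List (Vec (Fin n) k)
allVecs zero    n = [] ∷ []
allVecs (suc k) n = concatMap (λ i → map (i ∷_) (allVecs k n)) (allFin n)

-- σ : Fin n → Fin n is an involution of {1..n}: σ ∘ σ = id.
-- (Any such map is automatically a bijection, i.e. an element of 𝔖ₙ
--  with σ² = id; conversely every involution in 𝔖ₙ arises exactly once.)
IsInvolution : {n : ℕ} → Vec (Fin n) n → Set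
IsInvolution {n} σ = ∀ (i : Fin n) → lookup σ (lookup σ i) ≡ i

isInvolution? : {n : ℕ} (σ : Vec (Fin n) n) → Dec (IsInvolution σ)
isInvolution? σ = all? (λ i → lookup σ (lookup σ i) ≟ i)

I₁ : ℕ → ℕ
I₁ n = length (filter isInvolution? (allVecs n n))

a : ℕ → ℕ
a zero    = I₁ zero
a (suc n) = a n + I₁ (suc n)

sgn : ℕ → ℤ
sgn zero          = + 1
sgn (suc zero)    = - (+ 1)
sgn (suc (suc k)) = sgn k

lhsSum : (n K : ℕ) → ℤ
lhsSum n zero    = + 0
lhsSum n (suc k) = lhsSum n k +ℤ (sgn (n ∸ suc k) *ℤ + ((n C suc k) * a k))

LHS : ℕ → ℤ
LHS n = lhsSum n n

oddValue : ℕ → ℕ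
oddValue m = Data.Nat._/_ ((2 * m) !) (2 ^ m * m !) {{m*n≢0 (2 ^ m) (m !) {{m^n≢0 2 m}} {{m !≢0}}}}
  where import Data.Nat

-- Sorting the involutions of n + 2 points by the image of the first point (fixed, or
-- swapped with one of the other n + 1 points) gives I₁(n+2) = I₁(n+1) + (n+1) I₁(n).
-- This is also the recurrence of Σₖ C(n,k) mₖ, where mₖ counts perfect matchings of
-- k points (m₂ⱼ = (2j)!/(2ʲ j!), m₂ⱼ₊₁ = 0), so I₁ is the binomial transform of m.
-- The left-hand side for n + 1 is the inverse binomial transform at n of the
-- differences aₖ − aₖ₋₁ = I₁(k) (a Pascal-rule step), hence equals mₙ.
module Submission where

open import Defs
open import Algebra.Definitions using (Involutive)
open import Axiom.UniquenessOfIdentityProofs using (module Decidable⇒UIP)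
open import Data.Bool using (T; true; false)
open import Data.Bool.Properties using (T-irrelevant)
open import Data.Empty using (⊥-elim)
open import Data.Fin using (Fin; zero; suc; punchIn; punchOut)
open import Data.Fin.Permutation using (↔⇒≡; Permutation; Permutation′; _⟨$⟩ʳ_; remove; insert; punchIn-permute; insert-punchIn)
open import Data.Fin.Permutation.Components using (transpose; transpose-inverse)
open import Data.Fin.Properties using (+↔⊎; *↔×; 0↔⊥; 1↔⊤; _≟_; punchIn-injective; punchIn-punchOut; suc-injective)
open import Data.List using (List; []; _∷_; _++_; map; concatMap; filter; length; allFin)
import Data.List as List
open import Data.List.Properties using (filter-++; length-++; length-map)
open import Data.Nat using (ℕ; zero; suc)
import Data.Nat as ℕ
open import Data.Product using (Σ; _×_; _,_; proj₁; proj₂)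
open import Data.Product.Function.Dependent.Propositional using (congˡ; Σ-↔)
open import Data.Product.Function.NonDependent.Propositional using (_×-cong_)
open import Data.Sum using (_⊎_; inj₁; inj₂)
open import Data.Sum.Function.Propositional using (_⊎-cong_)
open import Data.Unit using (tt)
open import Data.Vec using (Vec; []; _∷_; lookup; tabulate)
open import Data.Vec.Properties using (lookup∘tabulate; tabulate∘lookup; tabulate-cong)
open import Function using (_∘_; _↔_; mk↔ₛ′)
open import Function.Construct.Composition using (_↔-∘_)
open import Function.Properties.Inverse using (↔-refl; ↔-sym)
open import Function.Related.Propositional using (≡⇒; module EquationalReasoning)
open import Function.Related.TypeIsomorphisms using (Σ-assoc)
open import Level using (0ℓ)
open import Relation.Binary.PropositionalEquality
open import Relation.Nullary using (Dec; yes; no; does)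
open import Relation.Nullary.Irrelevant using (Irrelevant)
open import Relation.Unary using (Pred; Decidable)

module _ {A : Set} {P : Pred A 0ℓ} (P? : Decidable P) where

  filter-map : ∀ {B : Set} (h : B → A) (ys : List B) → filter P? (map h ys) ≡ map h (filter (P? ∘ h) ys)
  filter-map h []       = refl
  filter-map h (y ∷ ys) with does (P? (h y))
  ... | true  = cong (h y ∷_) (filter-map h ys)
  ... | false = filter-map h ys

  filter-concatMap : ∀ {B : Set} (g : B → List A) (xs : List B) →
                     filter P? (concatMap g xs) ≡ concatMap (filter P? ∘ g) xs
  filter-concatMap g []       = refl
  filter-concatMap g (x ∷ xs) =
    trans (filter-++ P? (g x) (concatMap g xs)) (cong (filter P? (g x) ++_) (filter-concatMap g xs))

  Fin-length-filter-singleton↔ : (x : A) → Fin (length (filter P? (x ∷ []))) ↔ T (does (P? x))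
  Fin-length-filter-singleton↔ x with does (P? x)
  ... | true  = 1↔⊤
  ... | false = 0↔⊥

Σ-Fin-suc↔ : ∀ {n} {B : Fin (suc n) → Set} → Σ (Fin (suc n)) B ↔ (B zero ⊎ Σ (Fin n) (B ∘ suc))
Σ-Fin-suc↔ = mk↔ₛ′
  (λ { (zero , b) → inj₁ b ; (suc i , b) → inj₂ (i , b) })
  (λ { (inj₁ b) → zero , b ; (inj₂ (i , b)) → suc i , b })
  (λ { (inj₁ b) → refl ; (inj₂ (i , b)) → refl })
  (λ { (zero , b) → refl ; (suc i , b) → refl })

Fin-length-concatMap-tabulate↔ : ∀ {A B : Set} n (f : Fin n → B) (g : B → List A) →
  Fin (length (concatMap g (List.tabulate f))) ↔ Σ (Fin n) (λ i → Fin (length (g (f i))))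
Fin-length-concatMap-tabulate↔ zero    f g = mk↔ₛ′ (λ ()) (λ ()) (λ ()) (λ ())
Fin-length-concatMap-tabulate↔ {A} (suc n) f g = begin
  Fin (length (g (f zero) ++ rest))
    ≡⟨ cong Fin (length-++ (g (f zero))) ⟩
  Fin (length (g (f zero)) ℕ.+ length rest)
    ↔⟨ +↔⊎ ⟩
  (Fin (length (g (f zero))) ⊎ Fin (length rest))
    ↔⟨ ↔-refl ⊎-cong Fin-length-concatMap-tabulate↔ n (f ∘ suc) g ⟩
  (Fin (length (g (f zero))) ⊎ Σ (Fin n) (λ i → Fin (length (g (f (suc i))))))
    ↔⟨ ↔-sym Σ-Fin-suc↔ ⟩
  Σ (Fin (suc n)) (λ i → Fin (length (g (f i)))) ∎
  where
  open EquationalReasoning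
  rest : List A
  rest = concatMap g (List.tabulate (f ∘ suc))

Vec-suc↔ : ∀ {A : Set} {k} {Q : Vec A (suc k) → Set} →
           Σ A (λ x → Σ (Vec A k) (λ xs → Q (x ∷ xs))) ↔ Σ (Vec A (suc k)) Q
Vec-suc↔ = mk↔ₛ′ (λ { (x , xs , q) → x ∷ xs , q }) (λ { (x ∷ xs , q) → x , xs , q })
                 (λ { (x ∷ xs , q) → refl }) (λ { (x , xs , q) → refl })

Vec-zero↔ : ∀ {A : Set} {Q : Vec A 0 → Set} → Q [] ↔ Σ (Vec A 0) Q
Vec-zero↔ = mk↔ₛ′ ([] ,_) (λ { ([] , q) → q }) (λ { ([] , q) → refl }) (λ _ → refl)

Fin-length-filter-allVecs↔ : ∀ k {n} {P : Pred (Vec (Fin n) k) 0ℓ} (P? : Decidable P) →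
  Fin (length (filter P? (allVecs k n))) ↔ Σ (Vec (Fin n) k) (λ v → T (does (P? v)))
Fin-length-filter-allVecs↔ zero    P? = Vec-zero↔ ↔-∘ Fin-length-filter-singleton↔ P? []
Fin-length-filter-allVecs↔ (suc k) {n} P? = begin
  Fin (length (filter P? (concatMap prefixed (allFin n))))
    ≡⟨ cong (Fin ∘ length) (filter-concatMap P? prefixed (allFin n)) ⟩
  Fin (length (concatMap (filter P? ∘ prefixed) (allFin n)))
    ↔⟨ Fin-length-concatMap-tabulate↔ n (λ i → i) (filter P? ∘ prefixed) ⟩
  Σ (Fin n) (λ i → Fin (length (filter P? (prefixed i))))
    ↔⟨ congˡ (λ {i} → Fin-length-filter-allVecs↔ k (P? ∘ (i ∷_)) ↔-∘ ≡⇒ (cong Fin (length-filter-prefixed i))) ⟩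
  Σ (Fin n) (λ i → Σ (Vec (Fin n) k) (λ w → T (does (P? (i ∷ w)))))
    ↔⟨ Vec-suc↔ ⟩
  Σ (Vec (Fin n) (suc k)) (λ v → T (does (P? v))) ∎
  where
  open EquationalReasoning
  prefixed : Fin n → List (Vec (Fin n) (suc k))
  prefixed i = map (i ∷_) (allVecs k n)
  length-filter-prefixed : ∀ i → length (filter P? (prefixed i)) ≡ length (filter (P? ∘ (i ∷_)) (allVecs k n))
  length-filter-prefixed i =
    trans (cong length (filter-map P? (i ∷_) (allVecs k n))) (length-map (i ∷_) (filter (P? ∘ (i ∷_)) (allVecs k n)))

T-does⇒ : ∀ {P : Set} (P? : Dec P) → T (does P?) → P
T-does⇒ (yes p) _ = p

⇒T-does : ∀ {P : Set} (P? : Dec P) → P → T (does P?)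
⇒T-does (yes _) _ = tt
⇒T-does (no ¬p) p = ¬p p

Fin-≡-irrelevant : ∀ {n} {i j : Fin n} → Irrelevant (i ≡ j)
Fin-≡-irrelevant = Decidable⇒UIP.≡-irrelevant _≟_

Fin-≡↔≡ : ∀ {m n} {i j : Fin m} {k l : Fin n} → (i ≡ j → k ≡ l) → (k ≡ l → i ≡ j) → (i ≡ j) ↔ (k ≡ l)
Fin-≡↔≡ to from = mk↔ₛ′ to from (λ _ → Fin-≡-irrelevant _ _) (λ _ → Fin-≡-irrelevant _ _)

≗-punchIn : ∀ {A : Set} {n} (p : Fin (suc n)) {f g : Fin (suc n) → A} →
            f p ≡ g p → (∀ k → f (punchIn p k) ≡ g (punchIn p k)) → f ≗ g
≗-punchIn p {f} {g} fp≡gp off x with p ≟ x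
... | yes refl = fp≡gp
... | no  p≢x  = subst (λ y → f y ≡ g y) (punchIn-punchOut p≢x) (off (punchOut p≢x))

Involution : ℕ → Set
Involution n = Σ (Vec (Fin n) n) (λ v → T (does (isInvolution? v)))

Fin-I₁↔Involution : ∀ n → Fin (I₁ n) ↔ Involution n
Fin-I₁↔Involution n = Fin-length-filter-allVecs↔ n isInvolution?

module _ {n : ℕ} where

  apply : Involution n → Fin n → Fin n
  apply (v , _) = lookup v

  apply-involutive : (σ : Involution n) → Involutive _≡_ (apply σ)
  apply-involutive (v , t) = T-does⇒ (isInvolution? v) t

  involution : (f : Fin n → Fin n) → Involutive _≡_ f → Involution n
  involution f f-inv = tabulate f , ⇒T-does (isInvolution? (tabulate f)) tabulate-involutive
    where
    tabulate-involutive : IsInvolution (tabulate f)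
    tabulate-involutive i =
      trans (cong (lookup (tabulate f)) (lookup∘tabulate f i)) (trans (lookup∘tabulate f (f i)) (f-inv i))

  ≗⇒≡ : ∀ {σ τ : Involution n} → apply σ ≗ apply τ → σ ≡ τ
  ≗⇒≡ {v , s} {w , t} σ≗τ with trans (sym (tabulate∘lookup v)) (trans (tabulate-cong σ≗τ) (tabulate∘lookup w))
  ... | refl = cong (v ,_) (T-irrelevant s t)

  Σ-≗⇒≡ : ∀ {P : Involution n → Set} → (∀ {σ} → Irrelevant (P σ)) →
          ∀ {x y : Σ (Involution n) P} → apply (proj₁ x) ≗ apply (proj₁ y) → x ≡ y
  Σ-≗⇒≡ P-irr {σ , p} {τ , q} σ≗τ with ≗⇒≡ {σ} {τ} σ≗τ
  ... | refl = cong (σ ,_) (P-irr p q)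

  asPermutation : (σ : Involution n) → Permutation′ n
  asPermutation σ = mk↔ₛ′ (apply σ) (apply σ) (apply-involutive σ) (apply-involutive σ)

module _ {n : ℕ} (π : Permutation′ (suc n)) {p : Fin (suc n)} (πp≡p : π ⟨$⟩ʳ p ≡ p) where

  punchIn-remove : ∀ k → punchIn p (remove p π ⟨$⟩ʳ k) ≡ π ⟨$⟩ʳ punchIn p k
  punchIn-remove k = sym (trans (punchIn-permute π p k) (cong (λ q → punchIn q (remove p π ⟨$⟩ʳ k)) πp≡p))

  remove-involutive : Involutive _≡_ (π ⟨$⟩ʳ_) → Involutive _≡_ (remove p π ⟨$⟩ʳ_)
  remove-involutive π-inv k = punchIn-injective p _ _ (begin
    punchIn p (ρ (ρ k))        ≡⟨ punchIn-remove (ρ k) ⟩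
    π ⟨$⟩ʳ punchIn p (ρ k)      ≡⟨ cong (π ⟨$⟩ʳ_) (punchIn-remove k) ⟩
    π ⟨$⟩ʳ (π ⟨$⟩ʳ punchIn p k) ≡⟨ π-inv (punchIn p k) ⟩
    punchIn p k                ∎)
    where
    open ≡-Reasoning
    ρ : Fin n → Fin n
    ρ = remove p π ⟨$⟩ʳ_

insert-self : ∀ {m n} i j (π : Permutation m n) → insert i j π ⟨$⟩ʳ i ≡ j
insert-self i j π with i ≟ i
... | yes _   = refl
... | no  i≢i = ⊥-elim (i≢i refl)

insert-involutive : ∀ {n} (p : Fin (suc n)) (π : Permutation′ n) →
                    Involutive _≡_ (π ⟨$⟩ʳ_) → Involutive _≡_ (insert p p π ⟨$⟩ʳ_)
insert-involutive {n} p π π-inv = ≗-punchIn p at-p off-p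
  where
  ι : Fin (suc n) → Fin (suc n)
  ι = insert p p π ⟨$⟩ʳ_
  at-p : ι (ι p) ≡ p
  at-p = trans (cong ι (insert-self p p π)) (insert-self p p π)
  off-p : ∀ k → ι (ι (punchIn p k)) ≡ punchIn p k
  off-p k = trans (cong ι (insert-punchIn p p π k))
                  (trans (insert-punchIn p p π (π ⟨$⟩ʳ k)) (cong (punchIn p) (π-inv k)))

module FixedPoint {n : ℕ} (p : Fin (suc n)) where

  Fixing : Set
  Fixing = Σ (Involution (suc n)) (λ σ → apply σ p ≡ p)

  restrict : Fixing → Involution n
  restrict (σ , σp≡p) = involution (remove p (asPermutation σ) ⟨$⟩ʳ_)
                                   (remove-involutive (asPermutation σ) σp≡p (apply-involutive σ))

  extend : Involution n → Fixing
  extend τ = involution ι (insert-involutive p (asPermutation τ) (apply-involutive τ))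
           , trans (lookup∘tabulate ι p) (insert-self p p (asPermutation τ))
    where ι = insert p p (asPermutation τ) ⟨$⟩ʳ_

  punchIn-restrict : ∀ x k → punchIn p (apply (restrict x) k) ≡ apply (proj₁ x) (punchIn p k)
  punchIn-restrict (σ , σp≡p) k =
    trans (cong (punchIn p) (lookup∘tabulate (remove p (asPermutation σ) ⟨$⟩ʳ_) k)) (punchIn-remove (asPermutation σ) σp≡p k)

  extend-punchIn : ∀ τ k → apply (proj₁ (extend τ)) (punchIn p k) ≡ punchIn p (apply τ k)
  extend-punchIn τ k =
    trans (lookup∘tabulate (insert p p (asPermutation τ) ⟨$⟩ʳ_) (punchIn p k)) (insert-punchIn p p (asPermutation τ) k)

  ↔Involution : Fixing ↔ Involution n
  ↔Involution = mk↔ₛ′ restrict extend restrict∘extend extend∘restrict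
    where
    restrict∘extend : ∀ τ → restrict (extend τ) ≡ τ
    restrict∘extend τ = ≗⇒≡ λ k →
      punchIn-injective p _ _ (trans (punchIn-restrict (extend τ) k) (extend-punchIn τ k))
    extend∘restrict : ∀ x → extend (restrict x) ≡ x
    extend∘restrict x@(σ , σp≡p) = Σ-≗⇒≡ Fin-≡-irrelevant (≗-punchIn p
      (trans (proj₂ (extend (restrict x))) (sym σp≡p))
      (λ k → trans (extend-punchIn (restrict x) k) (punchIn-restrict x k)))

module _ {n : ℕ} (a b : Fin n) where

  transpose-left : transpose a b a ≡ b
  transpose-left with a ≟ a
  ... | yes _   = refl
  ... | no  a≢a = ⊥-elim (a≢a refl)

  transpose-right : transpose a b b ≡ a
  transpose-right with b ≟ a
  ... | yes b≡a = b≡a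
  ... | no  _ with b ≟ b
  ...   | yes _   = refl
  ...   | no  b≢b = ⊥-elim (b≢b refl)

  transpose-other : ∀ {x} → x ≢ a → x ≢ b → transpose a b x ≡ x
  transpose-other {x} x≢a x≢b with x ≟ a
  ... | yes x≡a = ⊥-elim (x≢a x≡a)
  ... | no  _ with x ≟ b
  ...   | yes x≡b = ⊥-elim (x≢b x≡b)
  ...   | no  _   = refl

  transpose-∘-involutive : ∀ {f : Fin n → Fin n} → Involutive _≡_ f →
    (∀ {x} → x ≢ a → x ≢ b → f x ≢ a × f x ≢ b) →
    (let h = transpose a b ∘ f in h (h a) ≡ a × h (h b) ≡ b) →
    Involutive _≡_ (transpose a b ∘ f)
  transpose-∘-involutive {f} f-inv off (at-a , at-b) x with x ≟ a | x ≟ b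
  ... | yes refl | _        = at-a
  ... | no  _    | yes refl = at-b
  ... | no  x≢a  | no  x≢b  = let (fx≢a , fx≢b) = off x≢a x≢b in
    trans (cong (transpose a b ∘ f) (transpose-other fx≢a fx≢b))
          (trans (cong (transpose a b) (f-inv x)) (transpose-other x≢a x≢b))

involutive⇒injective : ∀ {n} {f : Fin n → Fin n} → Involutive _≡_ f → ∀ {x y} → f x ≡ f y → x ≡ y
involutive⇒injective {f = f} f-inv {x} {y} fx≡fy = trans (sym (f-inv x)) (trans (cong f fx≡fy) (f-inv y))

-- Composing with the transposition (a b) turns involutions swapping a and b into
-- involutions fixing both, and back.
module Untwist {n : ℕ} (a b : Fin n) where

  Swapping : Set
  Swapping = Σ (Involution n) (λ σ → apply σ a ≡ b)

  FixingBoth : Set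
  FixingBoth = Σ (Involution n) (λ g → apply g a ≡ a × apply g b ≡ b)

  untwist : Swapping → FixingBoth
  untwist (σ , σa≡b) = involution h h-inv , trans (lookup∘tabulate h a) ha , trans (lookup∘tabulate h b) hb
    where
    f h : Fin n → Fin n
    f = apply σ
    h = transpose a b ∘ f
    σb≡a : f b ≡ a
    σb≡a = trans (cong f (sym σa≡b)) (apply-involutive σ a)
    ha : h a ≡ a
    ha = trans (cong (transpose a b) σa≡b) (transpose-right a b)
    hb : h b ≡ b
    hb = trans (cong (transpose a b) σb≡a) (transpose-left a b)
    h-inv : Involutive _≡_ h
    h-inv = transpose-∘-involutive a b (apply-involutive σ)
      (λ x≢a x≢b → (λ fx≡a → x≢b (involutive⇒injective (apply-involutive σ) (trans fx≡a (sym σb≡a))))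
                 , (λ fx≡b → x≢a (involutive⇒injective (apply-involutive σ) (trans fx≡b (sym σa≡b)))))
      (trans (cong h ha) ha , trans (cong h hb) hb)

  twist : FixingBoth → Swapping
  twist (g , ga≡a , gb≡b) = involution h h-inv , trans (lookup∘tabulate h a) ha
    where
    f h : Fin n → Fin n
    f = apply g
    h = transpose b a ∘ f
    ha : h a ≡ b
    ha = trans (cong (transpose b a) ga≡a) (transpose-right b a)
    hb : h b ≡ a
    hb = trans (cong (transpose b a) gb≡b) (transpose-left b a)
    h-inv : Involutive _≡_ h
    h-inv = transpose-∘-involutive b a (apply-involutive g)
      (λ x≢b x≢a → (λ fx≡b → x≢b (involutive⇒injective (apply-involutive g) (trans fx≡b (sym gb≡b))))
                 , (λ fx≡a → x≢a (involutive⇒injective (apply-involutive g) (trans fx≡a (sym ga≡a)))))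
      (trans (cong h hb) ha , trans (cong h ha) hb)

  ↔FixingBoth : Swapping ↔ FixingBoth
  ↔FixingBoth = mk↔ₛ′ untwist twist untwist∘twist twist∘untwist
    where
    untwist∘twist : ∀ x → untwist (twist x) ≡ x
    untwist∘twist (g , _) = Σ-≗⇒≡ (λ (p , q) (p′ , q′) → cong₂ _,_ (Fin-≡-irrelevant p p′) (Fin-≡-irrelevant q q′))
      λ x → trans (lookup∘tabulate _ x)
                  (trans (cong (transpose a b) (lookup∘tabulate (transpose b a ∘ apply g) x)) (transpose-inverse a b))
    twist∘untwist : ∀ x → twist (untwist x) ≡ x
    twist∘untwist (σ , _) = Σ-≗⇒≡ Fin-≡-irrelevant
      λ x → trans (lookup∘tabulate _ x)
                  (trans (cong (transpose b a) (lookup∘tabulate (transpose a b ∘ apply σ) x)) (transpose-inverse b a))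

Σ-fibre↔ : ∀ {A S : Set} (g : A → S) → A ↔ Σ S (λ s → Σ A (λ x → g x ≡ s))
Σ-fibre↔ g = mk↔ₛ′ (λ x → g x , x , refl) (λ (_ , x , _) → x) (λ { (_ , x , refl) → refl }) (λ _ → refl)

swapping↔Involution : ∀ {n} (j : Fin (suc n)) → Untwist.Swapping zero (suc j) ↔ Involution n
swapping↔Involution {n} j = begin
  Untwist.Swapping zero (suc j)
    ↔⟨ Untwist.↔FixingBoth zero (suc j) ⟩
  Untwist.FixingBoth zero (suc j)
    ↔⟨ ↔-sym Σ-assoc ⟩
  Σ (FixedPoint.Fixing zero) (λ x → apply (proj₁ x) (suc j) ≡ suc j)
    ↔⟨ Σ-↔ (FixedPoint.↔Involution zero) (λ {x} → fibre {x}) ⟩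
  FixedPoint.Fixing j
    ↔⟨ FixedPoint.↔Involution j ⟩
  Involution n ∎
  where
  open EquationalReasoning
  fibre : ∀ {x} → (apply (proj₁ x) (suc j) ≡ suc j) ↔ (apply (FixedPoint.restrict zero x) j ≡ j)
  fibre {x} = Fin-≡↔≡ (λ e → suc-injective (trans (FixedPoint.punchIn-restrict zero x j) e))
                      (λ e → trans (sym (FixedPoint.punchIn-restrict zero x j)) (cong suc e))

I₁-suc-suc : ∀ n → I₁ (suc (suc n)) ≡ I₁ (suc n) ℕ.+ suc n ℕ.* I₁ n
I₁-suc-suc n = ↔⇒≡ (begin
  Fin (I₁ (suc (suc n)))
    ↔⟨ Fin-I₁↔Involution (suc (suc n)) ⟩
  Involution (suc (suc n))
    ↔⟨ Σ-fibre↔ (λ σ → apply σ zero) ⟩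
  Σ (Fin (suc (suc n))) (λ s → Σ (Involution (suc (suc n))) (λ σ → apply σ zero ≡ s))
    ↔⟨ Σ-Fin-suc↔ ⟩
  (FixedPoint.Fixing zero ⊎ Σ (Fin (suc n)) (λ j → Untwist.Swapping zero (suc j)))
    ↔⟨ FixedPoint.↔Involution zero ⊎-cong congˡ (swapping↔Involution _) ⟩
  (Involution (suc n) ⊎ (Fin (suc n) × Involution n))
    ↔⟨ ↔-sym (Fin-I₁↔Involution (suc n)) ⊎-cong (↔-refl ×-cong ↔-sym (Fin-I₁↔Involution n)) ⟩
  (Fin (I₁ (suc n)) ⊎ (Fin (suc n) × Fin (I₁ n)))
    ↔⟨ ↔-refl ⊎-cong ↔-sym *↔× ⟩
  (Fin (I₁ (suc n)) ⊎ Fin (suc n ℕ.* I₁ n))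
    ↔⟨ ↔-sym +↔⊎ ⟩
  Fin (I₁ (suc n) ℕ.+ suc n ℕ.* I₁ n) ∎)
  where open EquationalReasoning

module AlternatingSums where

  open import Data.Nat using (_∸_; _<?_; s≤s; z≤n; _^_; _!)
  import Data.Nat.Properties as ℕ
  open import Data.Nat.Combinatorics using (_C_; nCk+nC[k+1]≡[n+1]C[k+1]; nC1≡n)
  open import Data.Nat.Combinatorics.Specification using (k>n⇒nCk≡0)
  open import Data.Nat.DivMod using (m*n/n≡m)
  open import Data.Nat.Properties using (_!≢0)
  import Data.Nat.Tactic.RingSolver as ℕ-Solver
  open import Data.Integer using (ℤ; +_; -_; _+_; _*_; 0ℤ; 1ℤ; -1ℤ)
  open import Data.Integer.Properties
    using (+-comm; +-assoc; +-identityˡ; +-identityʳ; *-assoc; *-identityˡ; *-zeroʳ; *-distribˡ-+; neg-involutive; pos-+; pos-*)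
  open import Data.Integer.Tactic.RingSolver using (solve-∀)
  open ≡-Reasoning

  ∑ : ℕ → (ℕ → ℤ) → ℤ
  ∑ zero    f = 0ℤ
  ∑ (suc n) f = ∑ n f + f n

  ∑-cong : ∀ n {f g : ℕ → ℤ} → (∀ k → f k ≡ g k) → ∑ n f ≡ ∑ n g
  ∑-cong zero    f≗g = refl
  ∑-cong (suc n) f≗g = cong₂ _+_ (∑-cong n f≗g) (f≗g n)

  ∑-+ : ∀ n (f g : ℕ → ℤ) → ∑ n (λ k → f k + g k) ≡ ∑ n f + ∑ n g
  ∑-+ zero    f g = refl
  ∑-+ (suc n) f g = trans (cong (_+ (f n + g n)) (∑-+ n f g)) (interchange (∑ n f) (∑ n g) (f n) (g n))
    where
    interchange : ∀ a b c d → (a + b) + (c + d) ≡ (a + c) + (b + d)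
    interchange = solve-∀

  ∑-*ˡ : ∀ n c (f : ℕ → ℤ) → ∑ n (λ k → c * f k) ≡ c * ∑ n f
  ∑-*ˡ zero    c f = sym (*-zeroʳ c)
  ∑-*ˡ (suc n) c f = trans (cong (_+ c * f n) (∑-*ˡ n c f)) (sym (*-distribˡ-+ c (∑ n f) (f n)))

  ∑-suc : ∀ n (f : ℕ → ℤ) → ∑ (suc n) f ≡ f 0 + ∑ n (λ k → f (suc k))
  ∑-suc zero    f = +-comm 0ℤ (f 0)
  ∑-suc (suc n) f = trans (cong (_+ f (suc n)) (∑-suc n f)) (+-assoc (f 0) _ _)

  weightedSum : (ℕ → ℕ → ℤ) → ℕ → (ℕ → ℤ) → ℤ
  weightedSum c n f = ∑ (suc n) (λ k → c n k * f k)

  weightedSum-+ : ∀ c n (f g : ℕ → ℤ) →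
                  weightedSum c n (λ k → f k + g k) ≡ weightedSum c n f + weightedSum c n g
  weightedSum-+ c n f g =
    trans (∑-cong (suc n) (λ k → *-distribˡ-+ (c n k) (f k) (g k))) (∑-+ (suc n) _ _)

  -- Binomial (α = 1) and alternating (α = -1) sums have weights with this Pascal-type recurrence.
  module _ {c : ℕ → ℕ → ℤ} (α : ℤ)
           (c-top : ∀ n → c n (suc n) ≡ 0ℤ)
           (c-zero : ∀ n → c (suc n) 0 ≡ α * c n 0)
           (c-pascal : ∀ n k → c (suc n) (suc k) ≡ c n k + α * c n (suc k)) where

    weightedSum-suc : ∀ n f → weightedSum c (suc n) f ≡ weightedSum c n (f ∘ suc) + α * weightedSum c n f
    weightedSum-suc n f = begin
      weightedSum c (suc n) f
        ≡⟨ ∑-suc (suc n) (λ k → c (suc n) k * f k) ⟩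
      c (suc n) 0 * f 0 + ∑ (suc n) (λ k → c (suc n) (suc k) * f (suc k))
        ≡⟨ cong₂ _+_ (cong (_* f 0) (c-zero n)) split ⟩
      (α * c n 0) * f 0 + (weightedSum c n (f ∘ suc) + α * R)
        ≡⟨ rearrange α (c n 0) (f 0) (weightedSum c n (f ∘ suc)) R ⟩
      weightedSum c n (f ∘ suc) + α * (c n 0 * f 0 + R)
        ≡⟨ cong (λ t → weightedSum c n (f ∘ suc) + α * t) full ⟩
      weightedSum c n (f ∘ suc) + α * weightedSum c n f ∎
      where
      R : ℤ
      R = ∑ (suc n) (λ k → c n (suc k) * f (suc k))
      distrib : ∀ a b d x → (a + b * d) * x ≡ a * x + b * (d * x)
      distrib = solve-∀
      split : ∑ (suc n) (λ k → c (suc n) (suc k) * f (suc k)) ≡ weightedSum c n (f ∘ suc) + α * R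
      split = begin
        ∑ (suc n) (λ k → c (suc n) (suc k) * f (suc k))
          ≡⟨ ∑-cong (suc n) (λ k → trans (cong (_* f (suc k)) (c-pascal n k)) (distrib (c n k) α (c n (suc k)) (f (suc k)))) ⟩
        ∑ (suc n) (λ k → c n k * f (suc k) + α * (c n (suc k) * f (suc k)))
          ≡⟨ ∑-+ (suc n) _ _ ⟩
        weightedSum c n (f ∘ suc) + ∑ (suc n) (λ k → α * (c n (suc k) * f (suc k)))
          ≡⟨ cong (_+_ (weightedSum c n (f ∘ suc))) (∑-*ˡ (suc n) α _) ⟩
        weightedSum c n (f ∘ suc) + α * R ∎
      rearrange : ∀ a b x y z → (a * b) * x + (y + a * z) ≡ y + a * (b * x + z)
      rearrange = solve-∀
      full : c n 0 * f 0 + R ≡ weightedSum c n f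
      full = begin
        c n 0 * f 0 + R                              ≡⟨ sym (∑-suc (suc n) (λ k → c n k * f k)) ⟩
        ∑ (suc (suc n)) (λ k → c n k * f k)          ≡⟨ cong (λ t → weightedSum c n f + t * f (suc n)) (c-top n) ⟩
        weightedSum c n f + 0ℤ * f (suc n)           ≡⟨ +-identityʳ (weightedSum c n f) ⟩
        weightedSum c n f                            ∎

  weightedSum-cong : ∀ c n {f g : ℕ → ℤ} → (∀ k → f k ≡ g k) → weightedSum c n f ≡ weightedSum c n g
  weightedSum-cong c n f≗g = ∑-cong (suc n) (λ k → cong (c n k *_) (f≗g k))

  nC[1+n]≡0 : ∀ n → n C suc n ≡ 0
  nC[1+n]≡0 n = k>n⇒nCk≡0 (ℕ.n<1+n n)

  binomialWeight : ℕ → ℕ → ℤ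
  binomialWeight n k = + (n C k)

  binomial : (ℕ → ℤ) → ℕ → ℤ
  binomial g n = weightedSum binomialWeight n g

  binomial-suc : ∀ g n → binomial g (suc n) ≡ binomial (λ k → g (suc k)) n + binomial g n
  binomial-suc g n = trans (weightedSum-suc {c = binomialWeight} 1ℤ (cong +_ ∘ nC[1+n]≡0) (λ _ → refl) pascal n g)
                           (cong (_+_ (binomial (λ k → g (suc k)) n)) (*-identityˡ (binomial g n)))
    where
    pascal : ∀ n k → + (suc n C suc k) ≡ + (n C k) + 1ℤ * + (n C suc k)
    pascal n k = trans (cong +_ (sym (nCk+nC[k+1]≡[n+1]C[k+1] n k)))
                       (trans (pos-+ (n C k) (n C suc k)) (cong (_+_ (+ (n C k))) (sym (*-identityˡ (+ (n C suc k))))))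

  sgn-suc : ∀ k → sgn (suc k) ≡ - sgn k
  sgn-suc zero    = refl
  sgn-suc (suc k) = trans (sym (neg-involutive (sgn k))) (cong -_ (sym (sgn-suc k)))

  signedWeight : ℕ → ℕ → ℤ
  signedWeight n k = sgn (n ∸ k) * + (n C k)

  alternating : ℕ → (ℕ → ℤ) → ℤ
  alternating = weightedSum signedWeight

  alternating-suc : ∀ n f → alternating (suc n) f ≡ alternating n (λ k → f (suc k)) + -1ℤ * alternating n f
  alternating-suc = weightedSum-suc {c = signedWeight} -1ℤ top bottom pascal
    where
    negate : ∀ s x → (- s) * x ≡ -1ℤ * (s * x)
    negate = solve-∀
    top : ∀ n → sgn (n ∸ suc n) * + (n C suc n) ≡ 0ℤ
    top n rewrite nC[1+n]≡0 n = *-zeroʳ (sgn (n ∸ suc n))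
    bottom : ∀ n → sgn (suc n) * + 1 ≡ -1ℤ * (sgn n * + 1)
    bottom n = trans (cong (_* + 1) (sgn-suc n)) (negate (sgn n) (+ 1))
    sign-flip : ∀ n k → sgn (n ∸ k) * + (n C suc k) ≡ -1ℤ * (sgn (n ∸ suc k) * + (n C suc k))
    sign-flip n k with k <? n
    ... | yes k<n = trans (cong (λ t → sgn t * + (n C suc k)) (ℕ.+-∸-assoc 1 k<n))
                          (trans (cong (_* + (n C suc k)) (sgn-suc (n ∸ suc k))) (negate (sgn (n ∸ suc k)) (+ (n C suc k))))
    ... | no k≮n rewrite k>n⇒nCk≡0 {n} {suc k} (s≤s (ℕ.≮⇒≥ k≮n)) =
      trans (*-zeroʳ (sgn (n ∸ k))) (sym (cong (-1ℤ *_) (*-zeroʳ (sgn (n ∸ suc k)))))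
    pascal : ∀ n k → sgn (n ∸ k) * + (suc n C suc k) ≡ sgn (n ∸ k) * + (n C k) + -1ℤ * (sgn (n ∸ suc k) * + (n C suc k))
    pascal n k = begin
      sgn (n ∸ k) * + (suc n C suc k)
        ≡⟨ cong (λ t → sgn (n ∸ k) * + t) (nCk+nC[k+1]≡[n+1]C[k+1] n k) ⟨
      sgn (n ∸ k) * + (n C k ℕ.+ n C suc k)
        ≡⟨ cong (sgn (n ∸ k) *_) (pos-+ (n C k) (n C suc k)) ⟩
      sgn (n ∸ k) * (+ (n C k) + + (n C suc k))
        ≡⟨ *-distribˡ-+ (sgn (n ∸ k)) _ _ ⟩
      sgn (n ∸ k) * + (n C k) + sgn (n ∸ k) * + (n C suc k)
        ≡⟨ cong (_+_ (sgn (n ∸ k) * + (n C k))) (sign-flip n k) ⟩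
      sgn (n ∸ k) * + (n C k) + -1ℤ * (sgn (n ∸ suc k) * + (n C suc k)) ∎

  alternating-difference : ∀ {f h : ℕ → ℤ} → (∀ k → f (suc k) ≡ h k + f k) →
                           ∀ n → alternating (suc n) f ≡ alternating n h
  alternating-difference {f} {h} step n = begin
    alternating (suc n) f                                        ≡⟨ alternating-suc n f ⟩
    alternating n (λ k → f (suc k)) + -1ℤ * alternating n f       ≡⟨ cong (_+ -1ℤ * alternating n f) linear ⟩
    (alternating n h + alternating n f) + -1ℤ * alternating n f  ≡⟨ cancel (alternating n h) (alternating n f) ⟩
    alternating n h                                              ∎
    where
    linear : alternating n (λ k → f (suc k)) ≡ alternating n h + alternating n f
    linear = trans (weightedSum-cong signedWeight n step) (weightedSum-+ signedWeight n h f)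
    cancel : ∀ x y → (x + y) + -1ℤ * y ≡ x
    cancel = solve-∀

  binomial-inversion : ∀ g n → alternating n (binomial g) ≡ g n
  binomial-inversion g zero    = base (g 0)
    where
    base : ∀ x → 0ℤ + + 1 * (0ℤ + + 1 * x) ≡ x
    base = solve-∀
  binomial-inversion g (suc n) =
    trans (alternating-difference (binomial-suc g) n) (binomial-inversion (g ∘ suc) n)

  [1+n]C[1+k]*[1+k]≡[1+n]*nCk : ∀ n k → (suc n C suc k) ℕ.* suc k ≡ suc n ℕ.* (n C k)
  [1+n]C[1+k]*[1+k]≡[1+n]*nCk n       zero    = cong (ℕ._* 1) (nC1≡n (suc n))
  [1+n]C[1+k]*[1+k]≡[1+n]*nCk zero    (suc k)
    rewrite k>n⇒nCk≡0 {1} {suc (suc k)} (s≤s (s≤s z≤n)) | k>n⇒nCk≡0 {0} {suc k} (s≤s z≤n) = refl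
  [1+n]C[1+k]*[1+k]≡[1+n]*nCk (suc n) (suc k) = begin
    (suc (suc n) C suc (suc k)) ℕ.* suc (suc k)
      ≡⟨ cong (ℕ._* suc (suc k)) (nCk+nC[k+1]≡[n+1]C[k+1] (suc n) (suc k)) ⟨
    (A ℕ.+ B) ℕ.* suc (suc k)
      ≡⟨ expand A B k ⟩
    A ℕ.* suc k ℕ.+ A ℕ.+ B ℕ.* suc (suc k)
      ≡⟨ cong₂ (λ u v → u ℕ.+ A ℕ.+ v) ([1+n]C[1+k]*[1+k]≡[1+n]*nCk n k) ([1+n]C[1+k]*[1+k]≡[1+n]*nCk n (suc k)) ⟩
    suc n ℕ.* (n C k) ℕ.+ A ℕ.+ suc n ℕ.* (n C suc k)
      ≡⟨ collect (suc n) (n C k) (n C suc k) A ⟩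
    suc n ℕ.* (n C k ℕ.+ n C suc k) ℕ.+ A
      ≡⟨ cong (λ t → suc n ℕ.* t ℕ.+ A) (nCk+nC[k+1]≡[n+1]C[k+1] n k) ⟩
    suc n ℕ.* A ℕ.+ A
      ≡⟨ ℕ.+-comm (suc n ℕ.* A) A ⟩
    suc (suc n) ℕ.* A ∎
    where
    A B : ℕ
    A = suc n C suc k
    B = suc n C suc (suc k)
    expand : ∀ a b k → (a ℕ.+ b) ℕ.* suc (suc k) ≡ a ℕ.* suc k ℕ.+ a ℕ.+ b ℕ.* suc (suc k)
    expand = ℕ-Solver.solve-∀
    collect : ∀ m p q a → m ℕ.* p ℕ.+ a ℕ.+ m ℕ.* q ≡ m ℕ.* (p ℕ.+ q) ℕ.+ a
    collect = ℕ-Solver.solve-∀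

  matchings : ℕ → ℕ
  matchings zero                = 1
  matchings (suc zero)          = 0
  matchings (suc (suc n))       = suc n ℕ.* matchings n

  binomial-matchings : ℕ → ℤ
  binomial-matchings = binomial (+_ ∘ matchings)

  binomial-matchings-suc-suc : ∀ n →
    binomial-matchings (suc (suc n)) ≡ binomial-matchings (suc n) + + suc n * binomial-matchings n
  binomial-matchings-suc-suc n = begin
    binomial-matchings (suc (suc n))
      ≡⟨ binomial-suc (+_ ∘ matchings) (suc n) ⟩
    binomial (+_ ∘ matchings ∘ suc) (suc n) + binomial-matchings (suc n)
      ≡⟨ +-comm _ (binomial-matchings (suc n)) ⟩
    binomial-matchings (suc n) + binomial (+_ ∘ matchings ∘ suc) (suc n)
      ≡⟨ cong (_+_ (binomial-matchings (suc n))) shifted ⟩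
    binomial-matchings (suc n) + + suc n * binomial-matchings n ∎
    where
    absorb : ∀ k → + (suc n C suc k) * + matchings (suc (suc k)) ≡ + suc n * (+ (n C k) * + matchings k)
    absorb k = begin
      + (suc n C suc k) * + (suc k ℕ.* matchings k)
        ≡⟨ pos-* (suc n C suc k) _ ⟨
      + ((suc n C suc k) ℕ.* (suc k ℕ.* matchings k))
        ≡⟨ cong +_ (ℕ.*-assoc (suc n C suc k) (suc k) (matchings k)) ⟨
      + ((suc n C suc k) ℕ.* suc k ℕ.* matchings k)
        ≡⟨ cong (λ t → + (t ℕ.* matchings k)) ([1+n]C[1+k]*[1+k]≡[1+n]*nCk n k) ⟩
      + (suc n ℕ.* (n C k) ℕ.* matchings k)
        ≡⟨ cong +_ (ℕ.*-assoc (suc n) (n C k) (matchings k)) ⟩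
      + (suc n ℕ.* ((n C k) ℕ.* matchings k))
        ≡⟨ pos-* (suc n) _ ⟩
      + suc n * + ((n C k) ℕ.* matchings k)
        ≡⟨ cong (+ suc n *_) (pos-* (n C k) (matchings k)) ⟩
      + suc n * (+ (n C k) * + matchings k) ∎
    shifted : binomial (+_ ∘ matchings ∘ suc) (suc n) ≡ + suc n * binomial-matchings n
    shifted = begin
      binomial (+_ ∘ matchings ∘ suc) (suc n)
        ≡⟨ ∑-suc (suc n) (λ k → + (suc n C k) * + matchings (suc k)) ⟩
      + 1 * 0ℤ + ∑ (suc n) (λ k → + (suc n C suc k) * + matchings (suc (suc k)))
        ≡⟨ cong (_+_ (+ 1 * 0ℤ)) (∑-cong (suc n) absorb) ⟩
      0ℤ + ∑ (suc n) (λ k → + suc n * (+ (n C k) * + matchings k))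
        ≡⟨ +-identityˡ _ ⟩
      ∑ (suc n) (λ k → + suc n * (+ (n C k) * + matchings k))
        ≡⟨ ∑-*ˡ (suc n) (+ suc n) _ ⟩
      + suc n * binomial-matchings n ∎

  second-order-unique : ∀ {u v : ℕ → ℤ} → u 0 ≡ v 0 → u 1 ≡ v 1 →
    (∀ n → u (suc (suc n)) ≡ u (suc n) + + suc n * u n) →
    (∀ n → v (suc (suc n)) ≡ v (suc n) + + suc n * v n) →
    ∀ n → u n ≡ v n
  second-order-unique {u} {v} u0 u1 u-rec v-rec n = proj₁ (both n)
    where
    both : ∀ n → u n ≡ v n × u (suc n) ≡ v (suc n)
    both zero    = u0 , u1
    both (suc n) with both n
    ... | uₙ , uₙ₊₁ = uₙ₊₁ , trans (u-rec n) (trans (cong₂ (λ x y → x + + suc n * y) uₙ₊₁ uₙ) (sym (v-rec n)))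

  partialSums : ℕ → ℤ
  partialSums zero    = 0ℤ
  partialSums (suc k) = + a k

  partialSums-suc : ∀ k → partialSums (suc k) ≡ + I₁ k + partialSums k
  partialSums-suc zero    = sym (+-identityʳ (+ I₁ 0))
  partialSums-suc (suc k) = trans (pos-+ (a k) (I₁ (suc k))) (+-comm (+ a k) (+ I₁ (suc k)))

  lhsSum≡∑ : ∀ n K → lhsSum n K ≡ ∑ (suc K) (λ k → signedWeight n k * partialSums k)
  lhsSum≡∑ n zero    = sym (trans (+-identityˡ _) (*-zeroʳ (signedWeight n 0)))
  lhsSum≡∑ n (suc K) = cong₂ _+_ (lhsSum≡∑ n K) term
    where
    term : sgn (n ∸ suc K) * + ((n C suc K) ℕ.* a K) ≡ signedWeight n (suc K) * + a K
    term = trans (cong (sgn (n ∸ suc K) *_) (pos-* (n C suc K) (a K))) (sym (*-assoc (sgn (n ∸ suc K)) _ _))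

  LHS≡alternating : ∀ n → LHS n ≡ alternating n partialSums
  LHS≡alternating n = lhsSum≡∑ n n

  I₁≡binomial-matchings : ∀ n → + I₁ n ≡ binomial-matchings n
  I₁≡binomial-matchings = second-order-unique refl refl rec binomial-matchings-suc-suc
    where
    rec : ∀ n → + I₁ (suc (suc n)) ≡ + I₁ (suc n) + + suc n * + I₁ n
    rec n = trans (cong +_ (I₁-suc-suc n)) (trans (pos-+ (I₁ (suc n)) _) (cong (_+_ (+ I₁ (suc n))) (pos-* (suc n) (I₁ n))))

  LHS-suc : ∀ n → LHS (suc n) ≡ + matchings n
  LHS-suc n = begin
    LHS (suc n)                             ≡⟨ LHS≡alternating (suc n) ⟩
    alternating (suc n) partialSums         ≡⟨ alternating-difference partialSums-suc n ⟩
    alternating n (+_ ∘ I₁)                  ≡⟨ weightedSum-cong signedWeight n I₁≡binomial-matchings ⟩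
    alternating n binomial-matchings        ≡⟨ binomial-inversion (+_ ∘ matchings) n ⟩
    + matchings n                           ∎

  matchings-odd : ∀ m → matchings (suc (2 ℕ.* m)) ≡ 0
  matchings-odd zero    = refl
  matchings-odd (suc m) = begin
    matchings (suc (2 ℕ.* suc m))                          ≡⟨ cong (matchings ∘ suc) (ℕ.*-suc 2 m) ⟩
    suc (suc (2 ℕ.* m)) ℕ.* matchings (suc (2 ℕ.* m))      ≡⟨ cong (suc (suc (2 ℕ.* m)) ℕ.*_) (matchings-odd m) ⟩
    suc (suc (2 ℕ.* m)) ℕ.* 0                              ≡⟨ ℕ.*-zeroʳ (suc (suc (2 ℕ.* m))) ⟩
    0                                                      ∎

  matchings-even : ∀ m → matchings (2 ℕ.* m) ℕ.* (2 ^ m ℕ.* m !) ≡ (2 ℕ.* m) !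
  matchings-even zero    = refl
  matchings-even (suc m) = begin
    matchings (2 ℕ.* suc m) ℕ.* (2 ^ suc m ℕ.* suc m !)
      ≡⟨ cong (λ t → matchings t ℕ.* (2 ^ suc m ℕ.* suc m !)) (ℕ.*-suc 2 m) ⟩
    suc (2 ℕ.* m) ℕ.* M ℕ.* (2 ℕ.* 2 ^ m ℕ.* (suc m ℕ.* m !))
      ≡⟨ regroup (2 ℕ.* m) M (2 ^ m) (m !) m ⟩
    (2 ℕ.* suc m) ℕ.* (suc (2 ℕ.* m) ℕ.* (M ℕ.* (2 ^ m ℕ.* m !)))
      ≡⟨ cong₂ (λ x y → x ℕ.* (suc (2 ℕ.* m) ℕ.* y)) (ℕ.*-suc 2 m) (matchings-even m) ⟩
    suc (suc (2 ℕ.* m)) !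
      ≡⟨ cong _! (sym (ℕ.*-suc 2 m)) ⟩
    (2 ℕ.* suc m) ! ∎
    where
    M : ℕ
    M = matchings (2 ℕ.* m)
    regroup : ∀ t x p f m → suc t ℕ.* x ℕ.* (2 ℕ.* p ℕ.* (suc m ℕ.* f))
                          ≡ (2 ℕ.* suc m) ℕ.* (suc t ℕ.* (x ℕ.* (p ℕ.* f)))
    regroup = ℕ-Solver.solve-∀

  oddValue≡matchings : ∀ m → oddValue m ≡ matchings (2 ℕ.* m)
  oddValue≡matchings m =
    trans (cong (λ t → ℕ._/_ t (2 ^ m ℕ.* m !) {{nonZero}}) (sym (matchings-even m)))
          (m*n/n≡m (matchings (2 ℕ.* m)) (2 ^ m ℕ.* m !) {{nonZero}})
    where
    nonZero : ℕ.NonZero (2 ^ m ℕ.* m !)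
    nonZero = ℕ.m*n≢0 (2 ^ m) (m !) {{ℕ.m^n≢0 2 m}} {{m !≢0}}

open AlternatingSums using (LHS-suc; matchings; matchings-odd; oddValue≡matchings)
open import Data.Nat using (_*_; _+_; _≥_)
open import Data.Nat.Properties using (+-comm; *-suc)
open import Data.Integer using (+_)
open ≡-Reasoning

corollary5p4 : (∀ (m : ℕ) → LHS (2 * m + 1) ≡ + oddValue m)
    × (∀ (m : ℕ) → m ≥ 1 → LHS (2 * m) ≡ + 0)
corollary5p4 = odd , even
  where
  odd : ∀ m → LHS (2 * m + 1) ≡ + oddValue m
  odd m = begin
    LHS (2 * m + 1)          ≡⟨ cong LHS (+-comm (2 * m) 1) ⟩
    LHS (suc (2 * m))        ≡⟨ LHS-suc (2 * m) ⟩
    + matchings (2 * m)      ≡⟨ cong +_ (oddValue≡matchings m) ⟨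
    + oddValue m             ∎
  even : ∀ m → m ≥ 1 → LHS (2 * m) ≡ + 0
  even (suc m) _ = begin
    LHS (2 * suc m)               ≡⟨ cong LHS (*-suc 2 m) ⟩
    LHS (suc (suc (2 * m)))       ≡⟨ LHS-suc (suc (2 * m)) ⟩
    + matchings (suc (2 * m))     ≡⟨ cong +_ (matchings-odd m) ⟩
    + 0                           ∎
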